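{- Let $X$ be a directed space. Then the map $\eta:X\to\widetilde{X}$, $\eta(x)={\downarrow}x$, is a topological embedding, where $\widetilde{X}$ carries its Scott topology.
   Context: Spaces are $T_0$ with specialization order $x\sqsubseteq y$ iff $x\in\overline{\{y\}}$; a directed $D$ converges to $x$ if it meets every open neighbourhood of $x$. A directed space is a $T_0$ space in which every set $U$ such that "for every directed $D$ and $x\in U$ with $D\to x$, $D\cap U\neq\emptyset$" is open. $\widetilde{X}$ is the d-closure of $\{{\downarrow}x:x\in X\}$ inside the dcpo $\Gamma(X)$ of nonempty closed subsets of $X$ ordered by inclusion (the smallest superset closed under existing directed suprema); it is a dcpo under inclusion. -}

module Defs where

open import Level using (Level; 0ℓ; _⊔_) renaming (suc to lsuc)
open import Data.Product using (Σ; ∃; _×_; _,_; proj₁; proj₂)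
open import Relation.Nullary using (¬_)
open import Relation.Binary.PropositionalEquality using (_≡_)
open import Function.Bundles using (_⇔_)
open import Function.Base using (id)
open import Function.Construct.Identity using (⇔-id)

-- A topological space, presented (predicatively) by a small type Ω of
-- codes of open sets with a membership relation, closed under the whole
-- space, binary intersections and unions of arbitrary Set-indexed families.
record Space : Set₁ where
  field
    Carrier : Set
    Ω       : Set
    _∈ₒ_    : Carrier → Ω → Set
    ⊤ₒ      : Ω
    ∈⊤ₒ     : ∀ x → x ∈ₒ ⊤ₒ
    _∩ₒ_    : Ω → Ω → Ω
    ∈∩ₒ     : ∀ x o o′ → (x ∈ₒ (o ∩ₒ o′)) ⇔ (x ∈ₒ o × x ∈ₒ o′)
    ⋃ₒ      : (I : Set) → (I → Ω) → Ω
    ∈⋃ₒ     : ∀ x (I : Set) (f : I → Ω) → (x ∈ₒ ⋃ₒ I f) ⇔ (∃ λ i → x ∈ₒ f i)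

module _ (X : Space) where
  open Space X

  IsOpen : ∀ {ℓ} → (Carrier → Set ℓ) → Set ℓ
  IsOpen U = Σ Ω λ o → ∀ x → (x ∈ₒ o) ⇔ U x

  IsClosed : ∀ {ℓ} → (Carrier → Set ℓ) → Set ℓ
  IsClosed C = Σ Ω λ o → ∀ x → C x ⇔ (¬ (x ∈ₒ o))

  Nonempty : (Carrier → Set) → Set
  Nonempty C = ∃ λ x → C x

  _⊆_ : (Carrier → Set) → (Carrier → Set) → Set
  A ⊆ B = ∀ x → A x → B x

  _⊑_ : Carrier → Carrier → Set
  x ⊑ y = ∀ o → x ∈ₒ o → y ∈ₒ o

  ↓_ : Carrier → Carrier → Set
  ↓ x = λ y → y ⊑ x

  IsT0 : Set
  IsT0 = ∀ x y → x ⊑ y → y ⊑ x → x ≡ y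

  Directed : (Carrier → Set) → Set
  Directed D = Nonempty D ×
    (∀ x y → D x → D y → ∃ λ z → D z × x ⊑ z × y ⊑ z)

  _converges-to_ : (Carrier → Set) → Carrier → Set
  D converges-to x = ∀ o → x ∈ₒ o → ∃ λ d → D d × d ∈ₒ o

  IsDirectedSpace : Set₁
  IsDirectedSpace = IsT0 ×
    (∀ (U : Carrier → Set) →
       (∀ (D : Carrier → Set) x → Directed D → U x → D converges-to x →
          ∃ λ d → D d × U d) →
       IsOpen U)

  InΓ : (Carrier → Set) → Set
  InΓ C = IsClosed C × Nonempty C

  DirectedFam : {I : Set₁} → (I → Carrier → Set) → Set₁
  DirectedFam {I} F = I × (∀ i j → Σ I λ k → F i ⊆ F k × F j ⊆ F k)

  IsSupΓ : {I : Set₁} → (I → Carrier → Set) → (Carrier → Set) → Set₁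
  IsSupΓ {I} F S = InΓ S × (∀ i → F i ⊆ S) ×
    (∀ (T : Carrier → Set) → InΓ T → (∀ i → F i ⊆ T) → S ⊆ T)

  -- X̃: the d-closure of {↓x} in Γ(X): smallest subset containing every
  -- ↓x and closed under directed suprema (taken in Γ(X)).
  data InX̃ : (Carrier → Set) → Set₂ where
    principal : ∀ {C} x → (∀ y → C y ⇔ (↓ x) y) → InX̃ C
    dsup      : ∀ {C} (I : Set₁) (F : I → Carrier → Set) →
                (∀ i → InX̃ (F i)) → DirectedFam F → IsSupΓ F C → InX̃ C

  X̃ : Set₂
  X̃ = Σ (Carrier → Set) InX̃

  _≤̃_ : X̃ → X̃ → Set
  a ≤̃ b = proj₁ a ⊆ proj₁ b

  η : Carrier → X̃
  η x = (↓ x) , principal x (λ y → ⇔-id _)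

  DirectedX̃ : {I : Set₂} → (I → X̃) → Set₂
  DirectedX̃ {I} F = I × (∀ i j → Σ I λ k → F i ≤̃ F k × F j ≤̃ F k)

  IsSupX̃ : {I : Set₂} → (I → X̃) → X̃ → Set₂
  IsSupX̃ {I} F s = (∀ i → F i ≤̃ s) × (∀ t → (∀ i → F i ≤̃ t) → s ≤̃ t)

  IsScottOpen : (X̃ → Set₂) → Set₃
  IsScottOpen V =
    (∀ a b → a ≤̃ b → V a → V b) ×
    (∀ (I : Set₂) (F : I → X̃) (s : X̃) → DirectedX̃ F → IsSupX̃ F s →
       V s → ∃ λ i → V (F i))

  -- η is a topological embedding: injective (elements of X̃ are compared
  -- as sets, i.e. extensionally), continuous, and every open of X is the
  -- η-preimage of a Scott open set.
  IsEmbeddingη : Set₃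
  IsEmbeddingη =
    (∀ x y → (∀ z → (↓ x) z ⇔ (↓ y) z) → x ≡ y) ×
    (∀ V → IsScottOpen V → IsOpen (λ x → V (η x))) ×
    (∀ o → Σ (X̃ → Set₂) λ V → IsScottOpen V × (∀ x → (x ∈ₒ o) ⇔ V (η x)))

-- Continuity and openness of η both rest on the closure cl D of a directed set
-- D ⊆ X: it is the supremum in X̃ of the principal ideals ↓d (d ∈ D), and
-- more generally the closure of the union of a directed family in X̃ is its
-- supremum in X̃.  If V is Scott open and η x ∈ V, any directed D converging
-- to x has ↓x ⊆ cl D, so V contains some ↓d; as X is a directed space this
-- makes η⁻¹ V open.  Conversely an open o of X is the η-preimage of
-- {A | A meets o}, which is Scott open because a supremum meets o only if
-- the closure of the union does, hence only if some member does.
module Submission where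

open import Defs
open import Level using (suc; 0ℓ; Lift; lift; lower)
open import Axiom.ExcludedMiddle using (ExcludedMiddle)
open import Data.Product using (Σ; ∃; _×_; _,_; proj₁; proj₂)
open import Data.Empty using (⊥-elim)
open import Relation.Nullary using (¬_; Dec; yes; no)
open import Relation.Nullary.Decidable using (True; toWitness; fromWitness; map′)
open import Relation.Binary.PropositionalEquality using (_≡_; refl)
open import Function.Bundles using (_⇔_; mk⇔; Equivalence)
open import Function.Construct.Identity using (⇔-id)
open Equivalence

module Classical (em : ExcludedMiddle (suc (suc (suc 0ℓ)))) where

  decide₀ : (P : Set) → Dec P
  decide₀ P = map′ lower lift em

  decide₂ : (P : Set₂) → Dec P
  decide₂ P = map′ lower lift em

  -- Propositional resizing: subsets of X and index types of Γ(X)-families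
  -- are small, while X̃ and its Scott opens live in Set₂.
  Resized : Set₂ → Set
  Resized P = True (decide₂ P)

  resize : {P : Set₂} → P → Resized P
  resize = fromWitness

  unresize : {P : Set₂} → Resized P → P
  unresize = toWitness

module _ (X : Space) where
  open Space X

  Pred : Set₁
  Pred = Carrier → Set

  ⊑-refl : ∀ {x} → _⊑_ X x x
  ⊑-refl o xo = xo

  ⊑-trans : ∀ {x y z} → _⊑_ X x y → _⊑_ X y z → _⊑_ X x z
  ⊑-trans x⊑y y⊑z o xo = y⊑z o (x⊑y o xo)

  η-injective : IsT0 X → ∀ x y → (∀ z → (↓_ X x) z ⇔ (↓_ X y) z) → x ≡ y
  η-injective t0 x y ↓x≈↓y = t0 x y (to (↓x≈↓y x) ⊑-refl) (from (↓x≈↓y y) ⊑-refl)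

  IsClosed-resp-⇔ : ∀ {A B : Pred} → (∀ y → A y ⇔ B y) → IsClosed X A → IsClosed X B
  IsClosed-resp-⇔ A≈B (o , A≈∁o) =
    o , λ y → mk⇔ (λ b → to (A≈∁o y) (from (A≈B y) b)) (λ y∉o → to (A≈B y) (from (A≈∁o y) y∉o))

  Meets : Pred → Ω → Set
  Meets P o = ∃ λ z → P z × z ∈ₒ o

  module _ (em : ExcludedMiddle (suc (suc (suc 0ℓ)))) where
    open Classical em

    exterior : Pred → Ω
    exterior P = ⋃ₒ (Σ Ω λ o → ∀ z → P z → ¬ z ∈ₒ o) proj₁

    cl : Pred → Pred
    cl P y = ¬ y ∈ₒ exterior P

    cl-isClosed : ∀ P → IsClosed X (cl P)
    cl-isClosed P = exterior P , λ y → ⇔-id _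

    ∈cl⇒meets : ∀ {P y o} → cl P y → y ∈ₒ o → Meets P o
    ∈cl⇒meets {P} {y} {o} y∈clP yo with decide₀ (Meets P o)
    ... | yes meets = meets
    ... | no ¬meets = ⊥-elim (y∈clP (from (∈⋃ₒ y _ proj₁)
                        ((o , λ z pz zo → ¬meets (z , pz , zo)) , yo)))

    meets⇒∈cl : ∀ {P y} → (∀ o → y ∈ₒ o → Meets P o) → cl P y
    meets⇒∈cl {y = y} meets y∈ext with to (∈⋃ₒ y _ proj₁) y∈ext
    ... | (o , o∩P≡∅) , yo with meets o yo
    ... | z , pz , zo = o∩P≡∅ z pz zo

    ⊆cl : ∀ {P} → _⊆_ X P (cl P)
    ⊆cl z pz = meets⇒∈cl λ o zo → z , pz , zo

    cl-least : ∀ {P T} → IsClosed X T → _⊆_ X P T → _⊆_ X (cl P) T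
    cl-least (o , T≈∁o) P⊆T y y∈clP with decide₀ (y ∈ₒ o)
    ... | no y∉o = from (T≈∁o y) y∉o
    ... | yes yo with ∈cl⇒meets y∈clP yo
    ... | z , pz , zo = ⊥-elim (to (T≈∁o z) (P⊆T z pz) zo)

    ↓-isClosed : ∀ x → IsClosed X (↓_ X x)
    ↓-isClosed x = IsClosed-resp-⇔ cl-≡⇔↓ (cl-isClosed (_≡ x))
      where
      cl-≡⇔↓ : ∀ y → cl (_≡ x) y ⇔ (↓_ X x) y
      cl-≡⇔↓ y = mk⇔ (λ y∈cl o yo → x∈o (∈cl⇒meets y∈cl yo))
                     (λ y⊑x → meets⇒∈cl λ o yo → x , refl , y⊑x o yo)
        where
        x∈o : ∀ {o} → Meets (_≡ x) o → x ∈ₒ o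
        x∈o (_ , refl , xo) = xo

    InX̃⇒InΓ : ∀ {A} → InX̃ X A → InΓ X A
    InX̃⇒InΓ (principal x A≈↓x) =
      IsClosed-resp-⇔ (λ y → mk⇔ (from (A≈↓x y)) (to (A≈↓x y))) (↓-isClosed x) ,
      x , from (A≈↓x x) ⊑-refl
    InX̃⇒InΓ (dsup _ _ _ _ (A∈Γ , _)) = A∈Γ

    module _ {I : Set₂} (F : I → X̃ X) where

      ⋃ᶠ : Pred
      ⋃ᶠ z = Resized (∃ λ i → proj₁ (F i) z)

      ⊆⋃ᶠ : ∀ i → _⊆_ X (proj₁ (F i)) ⋃ᶠ
      ⊆⋃ᶠ i z z∈Fi = resize (i , z∈Fi)

      ⋃ᶠ-least : ∀ {T} → (∀ i → _⊆_ X (proj₁ (F i)) T) → _⊆_ X ⋃ᶠ T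
      ⋃ᶠ-least F⊆T z z∈⋃ with unresize z∈⋃
      ... | i , z∈Fi = F⊆T i z z∈Fi

      -- F reindexed by its image, so as to form a family indexed in Set₁
      Image : Set₁
      Image = Σ Pred λ A → Resized (∃ λ i → proj₁ (F i) ≡ A)

      image : I → Image
      image i = proj₁ (F i) , resize (i , refl)

      image-InX̃ : ∀ (j : Image) → InX̃ X (proj₁ j)
      image-InX̃ (A , A∈im) with unresize A∈im
      ... | i , refl = proj₂ (F i)

      image-directed : DirectedX̃ X F → DirectedFam X {Image} proj₁
      image-directed (i₀ , dir) = image i₀ , upper
        where
        upper : ∀ (a b : Image) → Σ Image λ c → _⊆_ X (proj₁ a) (proj₁ c) × _⊆_ X (proj₁ b) (proj₁ c)
        upper (A , A∈im) (B , B∈im) with unresize A∈im | unresize B∈im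
        ... | i , refl | j , refl with dir i j
        ... | k , i≤k , j≤k = image k , i≤k , j≤k

      cl⋃ᶠ-isSupΓ : DirectedX̃ X F → IsSupΓ X {Image} proj₁ (cl ⋃ᶠ)
      cl⋃ᶠ-isSupΓ (i₀ , _) =
        (cl-isClosed ⋃ᶠ , cl⋃ᶠ-nonempty (proj₂ (InX̃⇒InΓ (proj₂ (F i₀))))) ,
        image⊆cl⋃ᶠ ,
        λ T T∈Γ image⊆T → cl-least (proj₁ T∈Γ) (⋃ᶠ-least λ i → image⊆T (image i))
        where
        cl⋃ᶠ-nonempty : Nonempty X (proj₁ (F i₀)) → Nonempty X (cl ⋃ᶠ)
        cl⋃ᶠ-nonempty (z , z∈Fi₀) = z , ⊆cl z (⊆⋃ᶠ i₀ z z∈Fi₀)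
        image⊆cl⋃ᶠ : ∀ (j : Image) → _⊆_ X (proj₁ j) (cl ⋃ᶠ)
        image⊆cl⋃ᶠ (A , A∈im) z z∈A with unresize A∈im
        ... | i , refl = ⊆cl z (⊆⋃ᶠ i z z∈A)

      ⋁ : DirectedX̃ X F → X̃ X
      ⋁ dir = cl ⋃ᶠ , dsup Image proj₁ image-InX̃ (image-directed dir) (cl⋃ᶠ-isSupΓ dir)

      ⋁-isSup : (dir : DirectedX̃ X F) → IsSupX̃ X F (⋁ dir)
      ⋁-isSup _ =
        (λ i z z∈Fi → ⊆cl z (⊆⋃ᶠ i z z∈Fi)) ,
        λ t F≤t → cl-least (proj₁ (InX̃⇒InΓ (proj₂ t))) (⋃ᶠ-least F≤t)

    Elements : Pred → Set₂
    Elements D = Lift (suc (suc 0ℓ)) (Σ Carrier D)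

    ηᶠ : (D : Pred) → Elements D → X̃ X
    ηᶠ D (lift (d , _)) = η X d

    ηᶠ-directed : ∀ {D} → Directed X D → DirectedX̃ X (ηᶠ D)
    ηᶠ-directed {D} (d₀ , dir) = lift d₀ , upper
      where
      upper : ∀ a b → Σ (Elements D) λ c → _≤̃_ X (ηᶠ D a) (ηᶠ D c) × _≤̃_ X (ηᶠ D b) (ηᶠ D c)
      upper (lift (a , a∈D)) (lift (b , b∈D)) with dir a b a∈D b∈D
      ... | c , c∈D , a⊑c , b⊑c =
        lift (c , c∈D) , (λ y y⊑a → ⊑-trans y⊑a a⊑c) , (λ y y⊑b → ⊑-trans y⊑b b⊑c)

    η≤̃⋁ηᶠ : ∀ {D x} (D-directed : Directed X D) → _converges-to_ X D x →
            _≤̃_ X (η X x) (⋁ (ηᶠ D) (ηᶠ-directed D-directed))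
    η≤̃⋁ηᶠ {D} _ D→x y y⊑x = meets⇒∈cl λ o yo → meets-⋃ (D→x o (y⊑x o yo))
      where
      meets-⋃ : ∀ {o} → Meets D o → Meets (⋃ᶠ (ηᶠ D)) o
      meets-⋃ (d , d∈D , d∈o) = d , resize (lift (d , d∈D) , ⊑-refl) , d∈o

    η-continuous : IsDirectedSpace X → ∀ V → IsScottOpen X V → IsOpen X (λ x → V (η X x))
    η-continuous (_ , inaccessible⇒open) V (V-upper , V-inaccessible)
      with inaccessible⇒open (λ x → Resized (V (η X x))) ηV-inaccessible
      where
      ηV-inaccessible : ∀ D x → Directed X D → Resized (V (η X x)) → _converges-to_ X D x →
                        ∃ λ d → D d × Resized (V (η X d))
      ηV-inaccessible D x D-directed ηx∈V D→x
        with V-inaccessible (Elements D) (ηᶠ D) (⋁ (ηᶠ D) ηD-directed) ηD-directed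
               (⋁-isSup (ηᶠ D) ηD-directed) (V-upper _ _ (η≤̃⋁ηᶠ D-directed D→x) (unresize ηx∈V))
        where
        ηD-directed : DirectedX̃ X (ηᶠ D)
        ηD-directed = ηᶠ-directed D-directed
      ... | lift (d , d∈D) , ηd∈V = d , d∈D , resize ηd∈V
    ... | o , o≈ηV = o , λ x → mk⇔ (λ xo → unresize (to (o≈ηV x) xo)) (λ ηx∈V → from (o≈ηV x) (resize ηx∈V))

    MeetsX̃ : Ω → X̃ X → Set₂
    MeetsX̃ o A = Lift _ (Meets (proj₁ A) o)

    MeetsX̃-isScottOpen : ∀ o → IsScottOpen X (MeetsX̃ o)
    MeetsX̃-isScottOpen o = upper , inaccessible
      where
      upper : ∀ a b → _≤̃_ X a b → MeetsX̃ o a → MeetsX̃ o b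
      upper a b a≤b (lift (y , y∈a , yo)) = lift (y , a≤b y y∈a , yo)
      inaccessible : ∀ (I : Set₂) (F : I → X̃ X) s → DirectedX̃ X F → IsSupX̃ X F s →
                     MeetsX̃ o s → ∃ λ i → MeetsX̃ o (F i)
      inaccessible I F s dir (_ , s-least) (lift (y , y∈s , yo))
        with ∈cl⇒meets (s-least (⋁ F dir) (proj₁ (⋁-isSup F dir)) y y∈s) yo
      ... | z , z∈⋃ , zo with unresize z∈⋃
      ... | i , z∈Fi = i , lift (z , z∈Fi , zo)

    η-open : ∀ o → Σ (X̃ X → Set₂) λ V → IsScottOpen X V × (∀ x → (x ∈ₒ o) ⇔ V (η X x))
    η-open o = MeetsX̃ o , MeetsX̃-isScottOpen o ,
               λ x → mk⇔ (λ xo → lift (x , ⊑-refl , xo)) (λ { (lift (y , y⊑x , yo)) → y⊑x o yo })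

corollary4p7 : ExcludedMiddle (suc (suc (suc 0ℓ))) →
    (X : Space) → IsDirectedSpace X → IsEmbeddingη X
corollary4p7 em X X-directed =
  η-injective X (proj₁ X-directed) , η-continuous X em X-directed , η-open X em
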